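{- Let $G$ be a graph and $W$ a walk of $G$. Let $E_o$ be the set of edges traversed by $W$ an odd number of times, and $E_e$ the set of edges traversed by $W$ a non-zero even number of times. Then $W$ is equivalent to a walk $W_S$ that follows a walk $S$ in which each edge of $E_o$ appears exactly once and each edge of $E_e$ appears at most twice.
   Context: A walk of $G$ is a sequence of vertices in which consecutive vertices are adjacent (vertices and edges may repeat). Two walks are equivalent if their underlying multisets of traversed edges are equal. Given a walk $W=u_0u_1\dots u_l$, a walk $W'$ follows $W$ if there are nonnegative integers $i_0,\dots,i_{l-1}$ such that $W'=u_0(u_1u_0)^{i_0}u_1(u_2u_1)^{i_1}\dots u_{l-1}(u_lu_{l-1})^{i_{l-1}}u_l$, where $(u_{t+1}u_t)^{i}$ means inserting $i$ back-and-forth traversals (half-turns) along the edge $u_tu_{t+1}$; i.e. $W'$ is obtained by traversing $W$ from start to end and inserting half-turns along its edges. -}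

module Defs where

open import Data.Nat using (ℕ; zero; suc; _+_)
open import Data.Fin using (Fin; _≟_)
open import Data.Bool using (Bool; true; false; _∧_; _∨_; if_then_else_)
open import Data.List using (List; []; _∷_; _++_; replicate; concat)
open import Relation.Nullary using (¬_)
open import Relation.Nullary.Decidable using (⌊_⌋)
open import Relation.Binary.PropositionalEquality using (_≡_)

record Graph (n : ℕ) : Set₁ where
  field
    Adj     : Fin n → Fin n → Set
    adj-sym : ∀ {x y} → Adj x y → Adj y x
    irrefl  : ∀ {x} → ¬ Adj x x
open Graph public

data IsWalk {n : ℕ} (G : Graph n) : List (Fin n) → Set where
  single : ∀ u → IsWalk G (u ∷ [])
  step   : ∀ {u v rest} → Adj G u v → IsWalk G (v ∷ rest) → IsWalk G (u ∷ v ∷ rest)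

isEdge : {n : ℕ} → Fin n → Fin n → Fin n → Fin n → Bool
isEdge a b x y = (⌊ x ≟ a ⌋ ∧ ⌊ y ≟ b ⌋) ∨ (⌊ x ≟ b ⌋ ∧ ⌊ y ≟ a ⌋)

count : {n : ℕ} → Fin n → Fin n → List (Fin n) → ℕ
count a b []            = 0
count a b (x ∷ [])      = 0
count a b (x ∷ y ∷ rest) =
  (if isEdge a b x y then 1 else 0) + count a b (y ∷ rest)

-- Two walks are equivalent: the multisets of traversed edges coincide,
-- i.e. every edge {a,b} of G is traversed equally often.
Equivalent : {n : ℕ} → Graph n → List (Fin n) → List (Fin n) → Set
Equivalent G W W' = ∀ a b → Adj G a b → count a b W ≡ count a b W'

-- Follows W' W : W' = u0 (u1 u0)^{i0} u1 (u2 u1)^{i1} ... u_l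
data Follows {n : ℕ} : List (Fin n) → List (Fin n) → Set where
  f-single : ∀ u → Follows (u ∷ []) (u ∷ [])
  f-step   : ∀ {u v rest W'} (i : ℕ) →
             Follows W' (v ∷ rest) →
             Follows (u ∷ (concat (replicate i (v ∷ u ∷ [])) ++ W')) (u ∷ v ∷ rest)

{-# OPTIONS --safe #-}
-- While some edge is traversed at least three times, two of those traversals go in the
-- same direction, W = A p q B p q C.  Reversing the closed piece between them gives the
-- shorter walk A p (reverse B) q C, which traverses pq two times fewer and every other
-- edge equally often.  Induction on the length therefore yields a walk S traversing every
-- edge at most twice, with the parities of W and the same set of edges; each removed pair
-- of traversals is then restored as a half-turn along an occurrence of pq in S.
module Submission where

open import Defs
open import Data.Nat using (ℕ; _≤_; _%_; zero; suc)
open import Data.Fin using (Fin)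
open import Data.List using (List)
open import Data.Product using (Σ; _×_)
open import Relation.Nullary using (¬_)
open import Relation.Binary.PropositionalEquality using (_≡_)

open import Data.Nat using (_+_; _*_; _<_; _≤?_; s≤s; s≤s⁻¹)
open import Data.Nat.Properties using (+-assoc; +-identityʳ; n≤1+n; ≰⇒>)
open import Data.Nat.DivMod using (%-remove-+ˡ)
open import Data.Nat.Divisibility using (m∣m*n)
open import Data.Nat.Induction using (<-wellFounded)
open import Data.Nat.Tactic.RingSolver using (solve-∀)
open import Data.Fin using (_≟_)
open import Data.Fin.Properties using (all?; ¬∀⟶∃¬)
open import Data.Bool using (true; false; T; _∧_; _∨_; if_then_else_)
open import Data.Bool.Properties using (T-≡; T-∧; T-∨; ∧-comm; ∨-comm)
open import Data.List using ([]; _∷_; _++_; _ʳ++_; length; reverse; concat; replicate)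
open import Data.List.Properties using (++-assoc; unfold-reverse; reverse-++; length-++; length-reverse)
open import Data.Product using (_,_; ∃-syntax)
import Data.Product as Product
open import Data.Sum using (_⊎_; inj₁; inj₂)
import Data.Sum as Sum
open import Function.Base using (_∘_)
open import Function.Bundles using (Equivalence)
open import Induction.WellFounded using (Acc; acc)
open import Relation.Nullary using (yes; no; contradiction)
open import Relation.Nullary.Decidable using (⌊_⌋; toWitness)
open import Relation.Binary.PropositionalEquality using (refl; sym; trans; cong; cong₂; subst; module ≡-Reasoning)
open Equivalence using (to; from)
open ≡-Reasoning

private
  variable
    n k : ℕ
    G : Graph n
    a b p q u v x z : Fin n
    xs zs S W W′ WS : List (Fin n)

isEdge-flip : ∀ (a b x y : Fin n) → isEdge a b x y ≡ isEdge a b y x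
isEdge-flip a b x y =
  trans (∨-comm (⌊ x ≟ a ⌋ ∧ ⌊ y ≟ b ⌋) (⌊ x ≟ b ⌋ ∧ ⌊ y ≟ a ⌋))
        (cong₂ _∨_ (∧-comm ⌊ x ≟ b ⌋ ⌊ y ≟ a ⌋) (∧-comm ⌊ x ≟ a ⌋ ⌊ y ≟ b ⌋))

isEdge-sym : ∀ (a b x y : Fin n) → isEdge a b x y ≡ isEdge b a x y
isEdge-sym a b x y = ∨-comm (⌊ x ≟ a ⌋ ∧ ⌊ y ≟ b ⌋) (⌊ x ≟ b ⌋ ∧ ⌊ y ≟ a ⌋)

isEdge-endpoints : ∀ (a b x y : Fin n) → isEdge a b x y ≡ true → (x ≡ a × y ≡ b) ⊎ (x ≡ b × y ≡ a)
isEdge-endpoints a b x y e =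
  Sum.map endpoints endpoints (to (T-∨ {⌊ x ≟ a ⌋ ∧ ⌊ y ≟ b ⌋}) (from T-≡ e))
  where
  endpoints : ∀ {c d} → T (⌊ x ≟ c ⌋ ∧ ⌊ y ≟ d ⌋) → x ≡ c × y ≡ d
  endpoints {c} {d} t =
    Product.map (toWitness {a? = x ≟ c}) (toWitness {a? = y ≟ d}) (to (T-∧ {⌊ x ≟ c ⌋}) t)

hit : Fin n → Fin n → Fin n → Fin n → ℕ
hit a b x y = if isEdge a b x y then 1 else 0

hit-refl : ∀ (a b : Fin n) → hit a b a b ≡ 1
hit-refl a b with a ≟ a | b ≟ b
... | yes _   | yes _   = refl
... | no a≢a  | _       = contradiction refl a≢a
... | yes _   | no b≢b  = contradiction refl b≢b

hit-flip : ∀ (a b x y : Fin n) → hit a b x y ≡ hit a b y x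
hit-flip a b x y = cong (λ t → if t then 1 else 0) (isEdge-flip a b x y)

hit-cong : ∀ (p q u v : Fin n) → isEdge p q u v ≡ true → ∀ x y → hit x y u v ≡ hit x y p q
hit-cong p q u v e x y with isEdge-endpoints p q u v e
... | inj₁ (refl , refl) = refl
... | inj₂ (refl , refl) = hit-flip x y q p

count-sym : ∀ (a b : Fin n) xs → count a b xs ≡ count b a xs
count-sym a b []           = refl
count-sym a b (x ∷ [])     = refl
count-sym a b (x ∷ y ∷ xs) =
  cong₂ _+_ (cong (λ t → if t then 1 else 0) (isEdge-sym a b x y)) (count-sym a b (y ∷ xs))

count-cong : ∀ (a b p q : Fin n) → isEdge a b p q ≡ true → ∀ xs → count a b xs ≡ count p q xs
count-cong a b p q e xs with isEdge-endpoints a b p q e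
... | inj₁ (refl , refl) = refl
... | inj₂ (refl , refl) = count-sym _ _ xs

count-++ : ∀ (a b : Fin n) xs {z} zs →
           count a b (xs ++ z ∷ zs) ≡ count a b (xs ++ z ∷ []) + count a b (z ∷ zs)
count-++ a b []           zs = refl
count-++ a b (x ∷ []) {z} zs = cong (_+ count a b (z ∷ zs)) (sym (+-identityʳ (hit a b x z)))
count-++ a b (x ∷ y ∷ xs) zs =
  trans (cong (hit a b x y +_) (count-++ a b (y ∷ xs) zs)) (sym (+-assoc (hit a b x y) _ _))

count-ʳ++ : ∀ (a b : Fin n) x xs ys →
            count a b ((x ∷ xs) ʳ++ ys) ≡ count a b (x ∷ xs) + count a b (x ∷ ys)
count-ʳ++ a b x []       ys = refl
count-ʳ++ a b x (y ∷ xs) ys = begin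
  count a b ((y ∷ xs) ʳ++ (x ∷ ys))
    ≡⟨ count-ʳ++ a b y xs (x ∷ ys) ⟩
  count a b (y ∷ xs) + (hit a b y x + count a b (x ∷ ys))
    ≡⟨ cong (λ h → count a b (y ∷ xs) + (h + count a b (x ∷ ys))) (hit-flip a b y x) ⟩
  count a b (y ∷ xs) + (hit a b x y + count a b (x ∷ ys))
    ≡⟨ swap-+ (count a b (y ∷ xs)) (hit a b x y) (count a b (x ∷ ys)) ⟩
  hit a b x y + count a b (y ∷ xs) + count a b (x ∷ ys) ∎
  where
  swap-+ : ∀ c h d → c + (h + d) ≡ h + c + d
  swap-+ = solve-∀

count-reverse : ∀ (a b : Fin n) xs → count a b (reverse xs) ≡ count a b xs
count-reverse a b []       = refl
count-reverse a b (x ∷ xs) = trans (count-ʳ++ a b x xs []) (+-identityʳ _)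

walk-split : ∀ xs → IsWalk G (xs ++ z ∷ zs) → IsWalk G (xs ++ z ∷ []) × IsWalk G (z ∷ zs)
walk-split []           w = single _ , w
walk-split (x ∷ [])     (step xz w) = step xz (single _) , w
walk-split (x ∷ y ∷ xs) (step xy w) = Product.map₁ (step xy) (walk-split (y ∷ xs) w)

walk-join : ∀ xs → IsWalk G (xs ++ z ∷ []) → IsWalk G (z ∷ zs) → IsWalk G (xs ++ z ∷ zs)
walk-join []           _             w = w
walk-join (x ∷ [])     (step xz _)  w = step xz w
walk-join (x ∷ y ∷ xs) (step xy w₁) w = step xy (walk-join (y ∷ xs) w₁ w)

walk-ʳ++ : ∀ {x} xs ys → IsWalk G (x ∷ xs) → IsWalk G (x ∷ ys) → IsWalk G ((x ∷ xs) ʳ++ ys)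
walk-ʳ++ []       ys _           w = w
walk-ʳ++ {G = G} (y ∷ xs) ys (step xy w) w′ = walk-ʳ++ xs (_ ∷ ys) w (step (adj-sym G xy) w′)

walk-reverse : IsWalk G xs → IsWalk G (reverse xs)
walk-reverse {xs = x ∷ xs} w = walk-ʳ++ xs [] w (single x)

shortcut : List (Fin n) → Fin n → Fin n → List (Fin n) → List (Fin n) → List (Fin n)
shortcut A p q B C = A ++ p ∷ reverse B ++ q ∷ C

reverse-segment : ∀ (p q : Fin n) B → reverse (q ∷ B ++ p ∷ []) ≡ p ∷ reverse B ++ q ∷ []
reverse-segment p q B = trans (unfold-reverse q (B ++ p ∷ [])) (cong (_++ q ∷ []) (reverse-++ B (p ∷ [])))

shortcut-walk : ∀ A B C → IsWalk G (A ++ p ∷ q ∷ B ++ p ∷ q ∷ C) → IsWalk G (shortcut A p q B C)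
shortcut-walk {G = G} {p = p} {q = q} A B C w with walk-split A w
... | wA , step _ w₁ with walk-split (q ∷ B) w₁
... | wB , step _ wC =
  walk-join A wA (walk-join (p ∷ reverse B) (subst (IsWalk G) (reverse-segment p q B) (walk-reverse wB)) wC)

shortcut-count : ∀ (x y : Fin n) A B C →
  count x y (A ++ p ∷ q ∷ B ++ p ∷ q ∷ C) ≡ 2 * hit x y p q + count x y (shortcut A p q B C)
shortcut-count {p = p} {q = q} x y A B C = begin
  count x y (A ++ p ∷ q ∷ B ++ p ∷ q ∷ C)
    ≡⟨ count-++ x y A _ ⟩
  cA + (h + count x y ((q ∷ B) ++ p ∷ q ∷ C))
    ≡⟨ cong (λ c → cA + (h + c)) (count-++ x y (q ∷ B) _) ⟩
  cA + (h + (cB + (h + cC)))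
    ≡⟨ rearrange cA h cB cC ⟩
  2 * h + (cA + (cB + cC))
    ≡⟨ cong (λ c → 2 * h + (cA + (c + cC))) reversed ⟩
  2 * h + (cA + (count x y (p ∷ reverse B ++ q ∷ []) + cC))
    ≡⟨ cong (λ c → 2 * h + (cA + c)) (count-++ x y (p ∷ reverse B) _) ⟨
  2 * h + (cA + count x y (p ∷ reverse B ++ q ∷ C))
    ≡⟨ cong (2 * h +_) (count-++ x y A _) ⟨
  2 * h + count x y (shortcut A p q B C) ∎
  where
  h  = hit x y p q
  cA = count x y (A ++ p ∷ [])
  cB = count x y (q ∷ B ++ p ∷ [])
  cC = count x y (q ∷ C)
  rearrange : ∀ a h b c → a + (h + (b + (h + c))) ≡ 2 * h + (a + (b + c))
  rearrange = solve-∀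
  reversed : cB ≡ count x y (p ∷ reverse B ++ q ∷ [])
  reversed = trans (sym (count-reverse x y (q ∷ B ++ p ∷ []))) (cong (count x y) (reverse-segment p q B))

shortcut-shorter : ∀ A B C → length (shortcut A p q B C) < length (A ++ p ∷ q ∷ B ++ p ∷ q ∷ C)
shortcut-shorter {p = p} {q = q} A B C = subst (length (shortcut A p q B C) <_) lengths (n≤1+n _)
  where
  two-more : ∀ a b c → 2 + (a + (1 + (b + (1 + c)))) ≡ a + (2 + (b + (2 + c)))
  two-more = solve-∀
  lengths : 2 + length (shortcut A p q B C) ≡ length (A ++ p ∷ q ∷ B ++ p ∷ q ∷ C)
  lengths
    rewrite length-++ A {p ∷ q ∷ B ++ p ∷ q ∷ C} | length-++ B {p ∷ q ∷ C}
          | length-++ A {p ∷ reverse B ++ q ∷ C} | length-++ (reverse B) {q ∷ C} | length-reverse B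
    = two-more (length A) (length B) (length C)

record Traversal (a b : Fin n) (k : ℕ) (S : List (Fin n)) : Set where
  constructor traversal
  field
    before    : List (Fin n)
    from to   : Fin n
    after     : List (Fin n)
    split     : S ≡ before ++ from ∷ to ∷ after
    traverses : isEdge a b from to ≡ true
    remaining : k ≤ count a b (to ∷ after)

traversal-∷ : Traversal a b k S → Traversal a b k (x ∷ S)
traversal-∷ {x = x} (traversal A p q C refl e r) = traversal (x ∷ A) p q C refl e r

first-traversal : ∀ S → suc k ≤ count a b S → Traversal a b k S
first-traversal {k = k} {a = a} {b} (x ∷ S) = starting-at x S
  where
  starting-at : ∀ x S → suc k ≤ count a b (x ∷ S) → Traversal a b k (x ∷ S)
  starting-at x (y ∷ S) h with isEdge a b x y in e
  ... | true  = traversal [] x y S refl e (s≤s⁻¹ h)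
  ... | false = traversal-∷ (starting-at y S h)

record RepeatedArc (a b : Fin n) (S : List (Fin n)) : Set where
  constructor repeatedArc
  field
    before        : List (Fin n)
    from to       : Fin n
    between after : List (Fin n)
    split         : S ≡ before ++ from ∷ to ∷ between ++ from ∷ to ∷ after
    traverses     : isEdge a b from to ≡ true

split-nested : ∀ {A ys} B → xs ≡ A ++ x ∷ ys → ys ≡ B ++ zs → xs ≡ (A ++ x ∷ B) ++ zs
split-nested {A = A} B refl refl = sym (++-assoc A _ _)

-- If the second traversal started where the first one ends, then p ≡ q: a loop.
arc-twice : ∀ {A A′ C C′} → IsWalk G S → S ≡ A ++ p ∷ q ∷ C → q ∷ C ≡ A′ ++ p ∷ q ∷ C′ →
            isEdge a b p q ≡ true → RepeatedArc a b S
arc-twice {G = G} {A = A} {A′ = []} w refl refl _ with walk-split A w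
... | _ , step pp _ = contradiction pp (irrefl G)
arc-twice {p = p} {q} {A = A} {A′ = _ ∷ B} {C′ = C′} _ refl refl e = repeatedArc A p q B C′ refl e

repeated-arc : IsWalk G S → 3 ≤ count a b S → RepeatedArc a b S
repeated-arc {S = S} {a = a} {b} w h with first-traversal S h
... | traversal A₁ p₁ q₁ C₁ s₁ e₁ r₁ with first-traversal (q₁ ∷ C₁) r₁
... | traversal A₂ p₂ q₂ C₂ s₂ e₂ r₂ with first-traversal (q₂ ∷ C₂) r₂
... | traversal A₃ p₃ q₃ C₃ s₃ e₃ _
  with isEdge-endpoints a b p₁ q₁ e₁ | isEdge-endpoints a b p₂ q₂ e₂ | isEdge-endpoints a b p₃ q₃ e₃
... | inj₁ (refl , refl) | inj₁ (refl , refl) | _ = arc-twice w s₁ s₂ e₁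
... | inj₂ (refl , refl) | inj₂ (refl , refl) | _ = arc-twice w s₁ s₂ e₁
... | inj₁ (refl , refl) | inj₂ (refl , refl) | inj₁ (refl , refl) =
  arc-twice w s₁ (split-nested A₃ s₂ s₃) e₁
... | inj₂ (refl , refl) | inj₁ (refl , refl) | inj₂ (refl , refl) =
  arc-twice w s₁ (split-nested A₃ s₂ s₃) e₁
... | inj₁ (refl , refl) | inj₂ (refl , refl) | inj₂ (refl , refl) =
  arc-twice w (split-nested A₂ s₁ s₂) s₃ e₂
... | inj₂ (refl , refl) | inj₁ (refl , refl) | inj₁ (refl , refl) =
  arc-twice w (split-nested A₂ s₁ s₂) s₃ e₂

traversed-≤2-or-≥3 : ∀ (S : List (Fin n)) → (∀ a b → count a b S ≤ 2) ⊎ ∃[ a ] ∃[ b ] 3 ≤ count a b S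
traversed-≤2-or-≥3 S with all? (λ a → all? (λ b → count a b S ≤? 2))
... | yes ≤2 = inj₁ ≤2
... | no ≰2 with ¬∀⟶∃¬ _ _ (λ a → all? (λ b → count a b S ≤? 2)) ≰2
... | a , ≰2ₐ with ¬∀⟶∃¬ _ _ (λ b → count a b S ≤? 2) ≰2ₐ
... | b , ≰2ₐᵦ = inj₂ (a , b , ≰⇒> ≰2ₐᵦ)

half-turns : Fin n → Fin n → ℕ → List (Fin n)
half-turns v u i = concat (replicate i (v ∷ u ∷ []))

follows-refl : IsWalk G S → Follows S S
follows-refl (single u) = f-single u
follows-refl (step _ w) = f-step 0 (follows-refl w)

follows-∷ : Follows W (v ∷ S) → ∃[ W′ ] W ≡ v ∷ W′
follows-∷ (f-single _) = _ , refl
follows-∷ (f-step _ _) = _ , refl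

walk-half-turns : ∀ i → Adj G u v → IsWalk G (v ∷ xs) → IsWalk G (u ∷ half-turns v u i ++ v ∷ xs)
walk-half-turns zero          uv w = step uv w
walk-half-turns {G = G} (suc i) uv w = step uv (step (adj-sym G uv) (walk-half-turns i uv w))

follows-walk : Follows WS S → IsWalk G S → IsWalk G WS
follows-walk (f-single u) _ = single u
follows-walk (f-step i f) (step uv w) with follows-∷ f
... | _ , refl = walk-half-turns i uv (follows-walk f w)

insert-half-turn : Follows WS S → 1 ≤ count p q S →
  ∃[ WS′ ] Follows WS′ S × (∀ x y → count x y WS′ ≡ 2 * hit x y p q + count x y WS)
insert-half-turn {p = p} {q} (f-step {u} {v} {W' = W} i f) h with isEdge p q u v in e
... | true = _ , f-step (suc i) f , λ x y →
  let c = count x y (u ∷ half-turns v u i ++ W) in begin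
    hit x y u v + (hit x y v u + c)
      ≡⟨ cong₂ (λ s t → s + (t + c)) (hit-cong p q u v e x y)
               (trans (hit-flip x y v u) (hit-cong p q u v e x y)) ⟩
    hit x y p q + (hit x y p q + c)
      ≡⟨ twice (hit x y p q) c ⟩
    2 * hit x y p q + c ∎
  where
  twice : ∀ h c → h + (h + c) ≡ 2 * h + c
  twice = solve-∀
... | false with insert-half-turn f h | follows-∷ f
... | W⁺ , f⁺ , count-W⁺ | t , refl with follows-∷ f⁺
... | t⁺ , refl = _ , f-step i f⁺ , λ x y →
  let P = u ∷ half-turns v u i
      c = count x y (P ++ v ∷ [])
      h = 2 * hit x y p q in begin
    count x y (P ++ v ∷ t⁺)      ≡⟨ count-++ x y P t⁺ ⟩
    c + count x y (v ∷ t⁺)       ≡⟨ cong (c +_) (count-W⁺ x y) ⟩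
    c + (h + count x y (v ∷ t))  ≡⟨ swap c h (count x y (v ∷ t)) ⟩
    h + (c + count x y (v ∷ t))  ≡⟨ cong (h +_) (count-++ x y P t) ⟨
    h + count x y (P ++ v ∷ t)   ∎
  where
  swap : ∀ c h d → c + (h + d) ≡ h + (c + d)
  swap = solve-∀

record Skeleton (G : Graph n) (W : List (Fin n)) : Set where
  constructor skeleton
  field
    base walk      : List (Fin n)
    base-walk      : IsWalk G base
    follows-base   : Follows walk base
    walk-count     : ∀ x y → count x y walk ≡ count x y W
    base-count-≤2  : ∀ x y → count x y base ≤ 2
    base-parity    : ∀ x y → count x y base % 2 ≡ count x y W % 2
    base-covers    : ∀ x y → 1 ≤ count x y W → 1 ≤ count x y base

skeleton-self : IsWalk G W → (∀ x y → count x y W ≤ 2) → Skeleton G W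
skeleton-self w ≤2 = skeleton _ _ w (follows-refl w) (λ _ _ → refl) ≤2 (λ _ _ → refl) (λ _ _ h → h)

skeleton-+half-turn : (∀ x y → count x y W ≡ 2 * hit x y p q + count x y W′) → 1 ≤ count p q W′ →
                      Skeleton G W′ → Skeleton G W
skeleton-+half-turn {W = W} {p = p} {q} {W′} extra pq∈W′ (skeleton S WS w f WS-count ≤2 parity covers)
  with insert-half-turn f (covers p q pq∈W′)
... | WS⁺ , f⁺ , count-WS⁺ = skeleton S WS⁺ w f⁺ WS⁺-count ≤2 parity⁺ (λ x y → covers x y ∘ covers-W′ x y)
  where
  WS⁺-count : ∀ x y → count x y WS⁺ ≡ count x y W
  WS⁺-count x y = begin
    count x y WS⁺                       ≡⟨ count-WS⁺ x y ⟩
    2 * hit x y p q + count x y WS      ≡⟨ cong (2 * hit x y p q +_) (WS-count x y) ⟩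
    2 * hit x y p q + count x y W′      ≡⟨ extra x y ⟨
    count x y W                         ∎
  parity⁺ : ∀ x y → count x y S % 2 ≡ count x y W % 2
  parity⁺ x y = begin
    count x y S % 2                     ≡⟨ parity x y ⟩
    count x y W′ % 2                    ≡⟨ %-remove-+ˡ (count x y W′) (m∣m*n (hit x y p q)) ⟨
    (2 * hit x y p q + count x y W′) % 2 ≡⟨ cong (_% 2) (extra x y) ⟨
    count x y W % 2                     ∎
  covers-W′ : ∀ x y → 1 ≤ count x y W → 1 ≤ count x y W′
  covers-W′ x y h with isEdge x y p q in e | extra x y
  ... | true  | _      = subst (1 ≤_) (sym (count-cong x y p q e W′)) pq∈W′
  ... | false | W≡W′ = subst (1 ≤_) W≡W′ h

skeleton-acc : Acc _<_ (length W) → IsWalk G W → Skeleton G W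
skeleton-acc {W = W} (acc shorter) w with traversed-≤2-or-≥3 W
... | inj₁ ≤2 = skeleton-self w ≤2
... | inj₂ (a , b , ≥3) with repeated-arc w ≥3
... | repeatedArc A p q B C refl e =
  skeleton-+half-turn (λ x y → shortcut-count x y A B C) pq∈W′
    (skeleton-acc (shorter (shortcut-shorter A B C)) (shortcut-walk A B C w))
  where
  pq∈W′ : 1 ≤ count p q (shortcut A p q B C)
  pq∈W′ = s≤s⁻¹ (s≤s⁻¹ (subst (3 ≤_) removed-two ≥3))
    where
    removed-two : count a b W ≡ 2 + count p q (shortcut A p q B C)
    removed-two = begin
      count a b W                ≡⟨ count-cong a b p q e W ⟩
      count p q W                ≡⟨ shortcut-count p q A B C ⟩
      2 * hit p q p q + count′   ≡⟨ cong (λ h → 2 * h + count′) (hit-refl p q) ⟩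
      2 + count′                 ∎
      where count′ = count p q (shortcut A p q B C)

skeleton-of : IsWalk G W → Skeleton G W
skeleton-of w = skeleton-acc (<-wellFounded _) w

≤2-odd⇒≡1 : ∀ {m} → m ≤ 2 → m % 2 ≡ 1 → m ≡ 1
≤2-odd⇒≡1 {1} _ _ = refl
≤2-odd⇒≡1 {0} _ ()
≤2-odd⇒≡1 {2} _ ()
≤2-odd⇒≡1 {suc (suc (suc _))} (s≤s (s≤s ())) _

proposition4p4 : (n : ℕ) (G : Graph n) (W : List (Fin n)) → IsWalk G W →
    Σ (List (Fin n)) λ S → Σ (List (Fin n)) λ WS →
      IsWalk G S × IsWalk G WS × Follows WS S × Equivalent G W WS ×
      (∀ a b → Adj G a b → count a b W % 2 ≡ 1 → count a b S ≡ 1) ×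
      (∀ a b → Adj G a b → count a b W % 2 ≡ 0 → ¬ (count a b W ≡ 0) → count a b S ≤ 2)
proposition4p4 n G W w =
  base , walk , base-walk , follows-walk follows-base base-walk , follows-base ,
  (λ a b _ → sym (walk-count a b)) ,
  (λ a b _ odd → ≤2-odd⇒≡1 (base-count-≤2 a b) (trans (base-parity a b) odd)) ,
  (λ a b _ _ _ → base-count-≤2 a b)
  where open Skeleton (skeleton-of w)
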